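{- Let $G=(A,B,E)$ be a bipartite graph with bipartition $A,B$. Then: (i) $\ker_A(G)\cup\ker_B(G)=\ker(G)$; (ii) $|\ker(G)|+|\mathrm{diadem}(G)|=2\alpha(G)$; (iii) $|\ker_A(G)|+|\mathrm{diadem}_B(G)|=|\ker_B(G)|+|\mathrm{diadem}_A(G)|=\alpha(G)$; (iv) $\mathrm{diadem}_A(G)\cup\mathrm{diadem}_B(G)=\mathrm{diadem}(G)$.
   Context: For $X\subseteq V(G)$, $N(X)=\{v\in V(G):N(v)\cap X\neq\emptyset\}$ and $d(X)=|X|-|N(X)|$, with $d(\emptyset)=0$. An independent set $S$ is a critical independent set if $d(S)=\max\{d(I):I\text{ independent in }G\}$; $\ker(G)$ is the intersection and $\mathrm{diadem}(G)$ the union of all critical independent sets of $G$. $\alpha(G)$ is the independence number. For $X\subseteq A$ or $X\subseteq B$, the deficiency is $\delta(X)=|X|-|N(X)|$ (with $\delta(\emptyset)=0$); $\delta_0(A)=\max\{\delta(X):X\subseteq A\}$ and $\delta_0(B)=\max\{\delta(Y):Y\subseteq B\}$. A set $X\subseteq A$ is $A$-critical if $\delta(X)=\delta_0(A)$, and $Y\subseteq B$ is $B$-critical if $\delta(Y)=\delta_0(B)$. $\ker_A(G)$ (resp. $\mathrm{diadem}_A(G)$) is the intersection (resp. union) of all $A$-critical sets; $\ker_B(G)$ and $\mathrm{diadem}_B(G)$ are defined analogously with $B$-critical sets. -}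

module Defs where

open import Data.Nat using (ℕ; zero; suc)
open import Data.Bool using (Bool; true; false; _∧_; _∨_)
open import Data.Fin using (Fin)
open import Data.Vec using (tabulate; lookup)
open import Data.Fin.Subset using (Subset; _∈_; ∣_∣)
open import Data.Integer using (ℤ; +_; _-_; _≤_)
open import Data.Product using (_×_; Σ)
open import Relation.Binary.PropositionalEquality using (_≡_; _≢_)
open import Function.Bundles using (_⇔_)

anyFin : {n : ℕ} → (Fin n → Bool) → Bool
anyFin {zero}  f = false
anyFin {suc n} f = f Fin.zero ∨ anyFin (λ i → f (Fin.suc i))

-- A finite simple bipartite graph on vertex set Fin n, with a fixed
-- bipartition: side v ≡ false means v ∈ A, side v ≡ true means v ∈ B.
record BipGraph (n : ℕ) : Set where
  field
    adj       : Fin n → Fin n → Bool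
    adj-sym   : ∀ u v → adj u v ≡ adj v u
    side      : Fin n → Bool
    bipartite : ∀ u v → adj u v ≡ true → side u ≢ side v

module _ {n : ℕ} (G : BipGraph n) where
  open BipGraph G

  Nb : Subset n → Subset n
  Nb X = tabulate (λ v → anyFin (λ u → lookup X u ∧ adj v u))

  d : Subset n → ℤ
  d X = + ∣ X ∣ - + ∣ Nb X ∣

  Independent : Subset n → Set
  Independent X = ∀ u v → u ∈ X → v ∈ X → adj u v ≡ false

  CriticalIndependent : Subset n → Set
  CriticalIndependent S = Independent S × (∀ I → Independent I → d I ≤ d S)

  InA : Subset n → Set
  InA X = ∀ v → v ∈ X → side v ≡ false

  InB : Subset n → Set
  InB X = ∀ v → v ∈ X → side v ≡ true

  ACritical : Subset n → Set
  ACritical X = InA X × (∀ Y → InA Y → d Y ≤ d X)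

  BCritical : Subset n → Set
  BCritical X = InB X × (∀ Y → InB Y → d Y ≤ d X)

  IsIntersection : (Subset n → Set) → Subset n → Set
  IsIntersection P K = ∀ v → (v ∈ K ⇔ (∀ S → P S → v ∈ S))

  IsUnion : (Subset n → Set) → Subset n → Set
  IsUnion P D = ∀ v → (v ∈ D ⇔ Σ (Subset n) (λ S → P S × v ∈ S))

  IsKer IsDiadem IsKerA IsDiademA IsKerB IsDiademB : Subset n → Set
  IsKer     = IsIntersection CriticalIndependent
  IsDiadem  = IsUnion CriticalIndependent
  IsKerA    = IsIntersection ACritical
  IsDiademA = IsUnion ACritical
  IsKerB    = IsIntersection BCritical
  IsDiademB = IsUnion BCritical

  IsIndependenceNumber : ℕ → Set
  IsIndependenceNumber a =
    Σ (Subset n) (λ S → Independent S × ∣ S ∣ ≡ a)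
    × (∀ I → Independent I → ∣ I ∣ Data.Nat.≤ a)

-- For X ⊆ A let X⁺ = X ∪ (B − N(X)). It is independent and d(X) = |X⁺| − |B|, so the A-critical
-- sets are exactly those with |X⁺| = α, and for such X the set B − N(X) is B-critical. Since d is
-- supermodular, A-critical sets are closed under intersection, so ker_A(G) is itself A-critical and
-- diadem_B(G) = B − N(ker_A(G)); this gives (iii). As d(S) = d(S ∩ A) + d(S ∩ B), both traces of a
-- critical independent set are critical on their side, while X⁺ is critical independent for every
-- A-critical X; sorting vertices by side gives (i) and (iv), and (ii) is the sum of the identities (iii).

module Submission where

open import Defs
open import Data.Nat using (ℕ; _+_; _*_)
open import Data.Fin.Subset using (Subset; _∪_; ∣_∣)
open import Data.Product using (_×_)
open import Relation.Binary.PropositionalEquality using (_≡_)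

open import Algebra.Properties.CommutativeSemigroup using (interchange)
open import Data.Bool using (Bool; true; false; not; _∧_; _∨_)
open import Data.Bool.Properties
  using (T-≡; ¬-not; not-¬; not-involutive; ∧-conicalˡ; ∧-conicalʳ; ∨-zeroʳ)
  renaming (_≟_ to _≟ᵇ_)
open import Data.Fin using (Fin; zero; suc)
open import Data.Fin.Properties using (all?)
open import Data.Fin.Subset using (_∈_; _∉_; _⊆_; _∩_; ∁)
open import Data.Fin.Subset.Properties
  using ( _∈?_; ⊆-antisym; p⊆q⇒∣p∣≤∣q∣; Empty-unique; ∣⊥∣≡0; anySubset?
        ; x∈p∩q⁺; x∈p∩q⁻; x∈p∪q⁺; x∈p∪q⁻; x∈∁p⇒x∉p; x∉p⇒x∈∁p)
open import Data.Integer as ℤ using (ℤ; +_)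
import Data.Integer.Properties as ℤₚ
open import Data.Integer.Tactic.RingSolver using (solve-∀)
open import Data.List using (List; []; _∷_; allFin)
open import Data.List.Membership.Propositional using () renaming (_∈_ to _∈ₗ_)
open import Data.List.Membership.Propositional.Properties using (∈-allFin)
open import Data.List.Relation.Unary.Any using (here; there)
open import Data.Nat using (suc; _≤_; _≟_)
import Data.Nat.Properties as ℕ
open import Data.Product using (Σ; ∃; _,_; proj₁; proj₂)
open import Data.Sum using (_⊎_; inj₁; inj₂; [_,_]′)
open import Data.Vec using ([]; _∷_; tabulate; lookup)
import Data.Vec.Properties as Vec
open import Function.Bundles using (Equivalence)
open import Relation.Binary.PropositionalEquality
  using (refl; sym; trans; cong; cong₂; subst; subst₂; module ≡-Reasoning)
open import Relation.Nullary using (Dec; yes; no; does; ¬?; contradiction)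
open import Relation.Nullary.Decidable using (_×-dec_; _→-dec_; map′; toWitness; isYes≗does; dec-true; decidable-stable)

+-cancelʳ-≤ : ∀ {i j} k → i ℤ.+ k ℤ.≤ j ℤ.+ k → i ℤ.≤ j
+-cancelʳ-≤ {i} {j} k i+k≤j+k = subst₂ ℤ._≤_ (undo i) (undo j) (ℤₚ.+-monoˡ-≤ (ℤ.- k) i+k≤j+k)
  where
  undo : ∀ x → x ℤ.+ k ℤ.+ ℤ.- k ≡ x
  undo x = trans (ℤₚ.+-assoc x k (ℤ.- k))
                 (trans (cong (λ y → x ℤ.+ y) (ℤₚ.+-inverseʳ k)) (ℤₚ.+-identityʳ x))

m≤p∧q≤n⇒m-n≤p-q : ∀ {m n p q} → m ≤ p → q ≤ n → + m ℤ.- + n ℤ.≤ + p ℤ.- + q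
m≤p∧q≤n⇒m-n≤p-q m≤p q≤n = ℤₚ.+-mono-≤ (ℤ.+≤+ m≤p) (ℤₚ.neg-mono-≤ (ℤ.+≤+ q≤n))

[m+n]-[p+q]≡[m-p]+[n-q] : ∀ m n p q →
  + (m + n) ℤ.- + (p + q) ≡ (+ m ℤ.- + p) ℤ.+ (+ n ℤ.- + q)
[m+n]-[p+q]≡[m-p]+[n-q] m n p q =
  trans (cong₂ ℤ._-_ (ℤₚ.pos-+ m n) (ℤₚ.pos-+ p q)) (regroup (+ m) (+ n) (+ p) (+ q))
  where
  regroup : ∀ i j k l → (i ℤ.+ j) ℤ.- (k ℤ.+ l) ≡ (i ℤ.- k) ℤ.+ (j ℤ.- l)
  regroup = solve-∀

[m+k]-[k+n]≡m-n : ∀ m n k → + (m + k) ℤ.- + (k + n) ≡ + m ℤ.- + n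
[m+k]-[k+n]≡m-n m n k =
  trans (cong₂ ℤ._-_ (ℤₚ.pos-+ m k) (ℤₚ.pos-+ k n)) (cancel (+ m) (+ n) (+ k))
  where
  cancel : ∀ i j l → (i ℤ.+ l) ℤ.- (l ℤ.+ j) ≡ i ℤ.- j
  cancel = solve-∀

∈-tabulate⁺ : ∀ {n} {f : Fin n → Bool} {v} → f v ≡ true → v ∈ tabulate f
∈-tabulate⁺ {f = f} {v} fv = Vec.lookup⇒[]= v (tabulate f) (trans (Vec.lookup∘tabulate f v) fv)

∈-tabulate⁻ : ∀ {n} {f : Fin n → Bool} {v} → v ∈ tabulate f → f v ≡ true
∈-tabulate⁻ {f = f} {v} v∈f = trans (sym (Vec.lookup∘tabulate f v)) (Vec.[]=⇒lookup v∈f)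

anyFin⁺ : ∀ {n} (f : Fin n → Bool) {u} → f u ≡ true → anyFin f ≡ true
anyFin⁺ f {zero}  fu = cong (_∨ anyFin (λ i → f (suc i))) fu
anyFin⁺ f {suc u} fu =
  trans (cong (f zero ∨_) (anyFin⁺ (λ i → f (suc i)) fu)) (∨-zeroʳ (f zero))

anyFin⁻ : ∀ {n} (f : Fin n → Bool) → anyFin f ≡ true → ∃ λ u → f u ≡ true
anyFin⁻ {suc n} f any-f with f zero in f0
... | true  = zero , f0
... | false with anyFin⁻ (λ i → f (suc i)) any-f
...   | u , fu = suc u , fu

∣p∪q∣+∣p∩q∣≡∣p∣+∣q∣ : ∀ {n} (p q : Subset n) → ∣ p ∪ q ∣ + ∣ p ∩ q ∣ ≡ ∣ p ∣ + ∣ q ∣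
∣p∪q∣+∣p∩q∣≡∣p∣+∣q∣ []         []         = refl
∣p∪q∣+∣p∩q∣≡∣p∣+∣q∣ (true ∷ p)  (true ∷ q)  = cong suc (begin
  ∣ p ∪ q ∣ + (suc ∣ p ∩ q ∣) ≡⟨ ℕ.+-suc (∣ p ∪ q ∣) (∣ p ∩ q ∣) ⟩
  suc (∣ p ∪ q ∣ + ∣ p ∩ q ∣)   ≡⟨ cong suc (∣p∪q∣+∣p∩q∣≡∣p∣+∣q∣ p q) ⟩
  suc (∣ p ∣ + ∣ q ∣)           ≡⟨ ℕ.+-suc (∣ p ∣) (∣ q ∣) ⟨
  ∣ p ∣ + (suc ∣ q ∣)           ∎)
  where open ≡-Reasoning
∣p∪q∣+∣p∩q∣≡∣p∣+∣q∣ (true ∷ p)  (false ∷ q) = cong suc (∣p∪q∣+∣p∩q∣≡∣p∣+∣q∣ p q)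
∣p∪q∣+∣p∩q∣≡∣p∣+∣q∣ (false ∷ p) (true ∷ q)  =
  trans (cong suc (∣p∪q∣+∣p∩q∣≡∣p∣+∣q∣ p q)) (sym (ℕ.+-suc (∣ p ∣) (∣ q ∣)))
∣p∪q∣+∣p∩q∣≡∣p∣+∣q∣ (false ∷ p) (false ∷ q) = ∣p∪q∣+∣p∩q∣≡∣p∣+∣q∣ p q

module _ {n : ℕ} where

  ∣p∪q∣≡∣p∣+∣q∣ : ∀ {p q : Subset n} → (∀ {v} → v ∈ p → v ∉ q) → ∣ p ∪ q ∣ ≡ ∣ p ∣ + ∣ q ∣
  ∣p∪q∣≡∣p∣+∣q∣ {p} {q} disjoint = begin
    ∣ p ∪ q ∣             ≡⟨ ℕ.+-identityʳ _ ⟨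
    ∣ p ∪ q ∣ + 0         ≡⟨ cong (λ k → ∣ p ∪ q ∣ + k) ∣p∩q∣≡0 ⟨
    ∣ p ∪ q ∣ + ∣ p ∩ q ∣ ≡⟨ ∣p∪q∣+∣p∩q∣≡∣p∣+∣q∣ p q ⟩
    ∣ p ∣ + ∣ q ∣         ∎
    where
    open ≡-Reasoning
    ∣p∩q∣≡0 : ∣ p ∩ q ∣ ≡ 0
    ∣p∩q∣≡0 = trans (cong ∣_∣ (Empty-unique λ (v , v∈p∩q) →
                      let (v∈p , v∈q) = x∈p∩q⁻ p q v∈p∩q in disjoint v∈p v∈q))
                    (∣⊥∣≡0 n)

  ∣p∩∁q∣+∣q∣≡∣p∣ : ∀ {p q : Subset n} → q ⊆ p → ∣ p ∩ ∁ q ∣ + ∣ q ∣ ≡ ∣ p ∣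
  ∣p∩∁q∣+∣q∣≡∣p∣ {p} {q} q⊆p = trans (sym (∣p∪q∣≡∣p∣+∣q∣ outside-q)) (cong ∣_∣ [p∩∁q]∪q≡p)
    where
    outside-q : ∀ {v} → v ∈ p ∩ ∁ q → v ∉ q
    outside-q v∈p∩∁q = x∈∁p⇒x∉p (proj₂ (x∈p∩q⁻ p (∁ q) v∈p∩∁q))
    split : ∀ {v} → v ∈ p → v ∈ p ∩ ∁ q ⊎ v ∈ q
    split {v} v∈p with v ∈? q
    ... | yes v∈q = inj₂ v∈q
    ... | no  v∉q = inj₁ (x∈p∩q⁺ (v∈p , x∉p⇒x∈∁p v∉q))
    [p∩∁q]∪q≡p : (p ∩ ∁ q) ∪ q ≡ p
    [p∩∁q]∪q≡p = ⊆-antisym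
      (λ v∈∪ → [ (λ h → proj₁ (x∈p∩q⁻ p (∁ q) h)) , q⊆p ]′ (x∈p∪q⁻ (p ∩ ∁ q) q v∈∪))
      (λ v∈p → x∈p∪q⁺ (split v∈p))

module _ {n : ℕ} (G : BipGraph n) where
  open BipGraph G

  private
    N : Subset n → Subset n
    N = Nb G

    δ : Subset n → ℤ
    δ = d G

  ∈-N⁺ : ∀ {X u v} → u ∈ X → adj v u ≡ true → v ∈ N X
  ∈-N⁺ {X} {u} {v} u∈X vu =
    ∈-tabulate⁺ (anyFin⁺ (λ w → lookup X w ∧ adj v w) (cong₂ _∧_ (Vec.[]=⇒lookup u∈X) vu))

  ∈-N⁻ : ∀ X {v} → v ∈ N X → ∃ λ u → u ∈ X × adj v u ≡ true
  ∈-N⁻ X {v} v∈NX with anyFin⁻ (λ u → lookup X u ∧ adj v u) (∈-tabulate⁻ v∈NX)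
  ... | u , Xu∧vu = u , Vec.lookup⇒[]= u X (∧-conicalˡ _ _ Xu∧vu) , ∧-conicalʳ _ _ Xu∧vu

  N-∪ : ∀ X Z → N (X ∪ Z) ≡ N X ∪ N Z
  N-∪ X Z = ⊆-antisym ⊆∪ (λ v∈∪ → [ N-mono inj₁ , N-mono inj₂ ]′ (x∈p∪q⁻ (N X) (N Z) v∈∪))
    where
    ⊆∪ : N (X ∪ Z) ⊆ N X ∪ N Z
    ⊆∪ v∈N with ∈-N⁻ (X ∪ Z) v∈N
    ... | u , u∈X∪Z , vu = x∈p∪q⁺ ([ (λ u∈X → inj₁ (∈-N⁺ u∈X vu)) , (λ u∈Z → inj₂ (∈-N⁺ u∈Z vu)) ]′
                                    (x∈p∪q⁻ X Z u∈X∪Z))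
    N-mono : ∀ {Y} → (∀ {u} → u ∈ Y → u ∈ X ⊎ u ∈ Z) → N Y ⊆ N (X ∪ Z)
    N-mono {Y} Y⊆X∪Z v∈NY with ∈-N⁻ Y v∈NY
    ... | u , u∈Y , vu = ∈-N⁺ (x∈p∪q⁺ (Y⊆X∪Z u∈Y)) vu

  N-∩ : ∀ X Z → N (X ∩ Z) ⊆ N X ∩ N Z
  N-∩ X Z v∈N with ∈-N⁻ (X ∩ Z) v∈N
  ... | u , u∈X∩Z , vu with x∈p∩q⁻ X Z u∈X∩Z
  ...   | u∈X , u∈Z = x∈p∩q⁺ (∈-N⁺ u∈X vu , ∈-N⁺ u∈Z vu)

  ∣N∣-submodular : ∀ X Z → ∣ N (X ∪ Z) ∣ + ∣ N (X ∩ Z) ∣ ≤ ∣ N X ∣ + ∣ N Z ∣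
  ∣N∣-submodular X Z = begin
    ∣ N (X ∪ Z) ∣ + ∣ N (X ∩ Z) ∣   ≤⟨ ℕ.+-monoʳ-≤ (∣ N (X ∪ Z) ∣) (p⊆q⇒∣p∣≤∣q∣ (N-∩ X Z)) ⟩
    ∣ N (X ∪ Z) ∣ + ∣ N X ∩ N Z ∣   ≡⟨ cong (λ Y → ∣ Y ∣ + ∣ N X ∩ N Z ∣) (N-∪ X Z) ⟩
    ∣ N X ∪ N Z ∣ + ∣ N X ∩ N Z ∣   ≡⟨ ∣p∪q∣+∣p∩q∣≡∣p∣+∣q∣ (N X) (N Z) ⟩
    ∣ N X ∣ + ∣ N Z ∣               ∎
    where open ℕ.≤-Reasoning

  δ-supermodular : ∀ X Z → δ X ℤ.+ δ Z ℤ.≤ δ (X ∪ Z) ℤ.+ δ (X ∩ Z)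
  δ-supermodular X Z = begin
    δ X ℤ.+ δ Z
      ≡⟨ [m+n]-[p+q]≡[m-p]+[n-q] (∣ X ∣) (∣ Z ∣) (∣ N X ∣) (∣ N Z ∣) ⟨
    + (∣ X ∣ + ∣ Z ∣) ℤ.- + (∣ N X ∣ + ∣ N Z ∣)
      ≤⟨ m≤p∧q≤n⇒m-n≤p-q (ℕ.≤-reflexive (sym (∣p∪q∣+∣p∩q∣≡∣p∣+∣q∣ X Z))) (∣N∣-submodular X Z) ⟩
    + (∣ X ∪ Z ∣ + ∣ X ∩ Z ∣) ℤ.- + (∣ N (X ∪ Z) ∣ + ∣ N (X ∩ Z) ∣)
      ≡⟨ [m+n]-[p+q]≡[m-p]+[n-q] (∣ X ∪ Z ∣) (∣ X ∩ Z ∣) (∣ N (X ∪ Z) ∣) (∣ N (X ∩ Z) ∣) ⟩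
    δ (X ∪ Z) ℤ.+ δ (X ∩ Z)
      ∎
    where open ℤₚ.≤-Reasoning

  δ-∪ : ∀ {P Q} → (∀ {v} → v ∈ P → v ∉ Q) → (∀ {v} → v ∈ N P → v ∉ N Q) →
        δ (P ∪ Q) ≡ δ P ℤ.+ δ Q
  δ-∪ {P} {Q} P∩Q≡∅ NP∩NQ≡∅ = begin
    + ∣ P ∪ Q ∣ ℤ.- + ∣ N (P ∪ Q) ∣           ≡⟨ cong (λ Y → + ∣ P ∪ Q ∣ ℤ.- + ∣ Y ∣) (N-∪ P Q) ⟩
    + ∣ P ∪ Q ∣ ℤ.- + ∣ N P ∪ N Q ∣           ≡⟨ cong₂ (λ a b → + a ℤ.- + b)
                                                     (∣p∪q∣≡∣p∣+∣q∣ P∩Q≡∅) (∣p∪q∣≡∣p∣+∣q∣ NP∩NQ≡∅) ⟩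
    + (∣ P ∣ + ∣ Q ∣) ℤ.- + (∣ N P ∣ + ∣ N Q ∣) ≡⟨ [m+n]-[p+q]≡[m-p]+[n-q] (∣ P ∣) (∣ Q ∣) (∣ N P ∣) (∣ N Q ∣) ⟩
    δ P ℤ.+ δ Q                               ∎
    where open ≡-Reasoning

  OnSide : Bool → Subset n → Set
  OnSide b X = ∀ v → v ∈ X → side v ≡ b

  -- Critical false and Critical true unfold to ACritical G and BCritical G.
  Critical : Bool → Subset n → Set
  Critical b X = OnSide b X × (∀ Y → OnSide b Y → δ Y ℤ.≤ δ X)

  onSide? : ∀ b X → Dec (OnSide b X)
  onSide? b X = all? λ v → v ∈? X →-dec side v ≟ᵇ b

  opposite-sides : ∀ {b X Y} → OnSide b X → OnSide (not b) Y → ∀ {v} → v ∈ X → v ∉ Y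
  opposite-sides X-b Y-¬b v∈X v∈Y = not-¬ (X-b _ v∈X) (Y-¬b _ v∈Y)

  N-onSide : ∀ {b X} → OnSide b X → OnSide (not b) (N X)
  N-onSide {X = X} X-b v v∈NX with ∈-N⁻ X v∈NX
  ... | u , u∈X , vu = ¬-not λ sv≡b → bipartite v u vu (trans sv≡b (sym (X-b u u∈X)))

  ∣∪∣-sides : ∀ {b X Y} → OnSide b X → OnSide (not b) Y → ∣ X ∪ Y ∣ ≡ ∣ X ∣ + ∣ Y ∣
  ∣∪∣-sides X-b Y-¬b = ∣p∪q∣≡∣p∣+∣q∣ (opposite-sides X-b Y-¬b)

  δ-∪-sides : ∀ {b X Y} → OnSide b X → OnSide (not b) Y → δ (X ∪ Y) ≡ δ X ℤ.+ δ Y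
  δ-∪-sides X-b Y-¬b =
    δ-∪ (opposite-sides X-b Y-¬b) (opposite-sides (N-onSide X-b) (N-onSide Y-¬b))

  union-onSide : ∀ {b D} → IsUnion G (Critical b) D → OnSide b D
  union-onSide D-union v v∈D with Equivalence.to (D-union v) v∈D
  ... | S , (S-b , _) , v∈S = S-b v v∈S

  ∪-sides≡ : ∀ {X₀ X₁ Y} → X₀ ⊆ Y → X₁ ⊆ Y →
             (∀ {v} → v ∈ Y → side v ≡ false → v ∈ X₀) → (∀ {v} → v ∈ Y → side v ≡ true → v ∈ X₁) →
             X₀ ∪ X₁ ≡ Y
  ∪-sides≡ {X₀} {X₁} {Y} X₀⊆Y X₁⊆Y Y₀⊆X₀ Y₁⊆X₁ =
    ⊆-antisym (λ v∈∪ → [ X₀⊆Y , X₁⊆Y ]′ (x∈p∪q⁻ X₀ X₁ v∈∪)) (λ v∈Y → x∈p∪q⁺ (bySide v∈Y _ refl))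
    where
    bySide : ∀ {v} → v ∈ Y → ∀ b → side v ≡ b → v ∈ X₀ ⊎ v ∈ X₁
    bySide v∈Y false v-0 = inj₁ (Y₀⊆X₀ v∈Y v-0)
    bySide v∈Y true  v-1 = inj₂ (Y₁⊆X₁ v∈Y v-1)

  critical-∩ : ∀ {b X Z} → Critical b X → Critical b Z → Critical b (X ∩ Z)
  critical-∩ {b} {X} {Z} (X-b , X-max) (Z-b , Z-max) =
    X∩Z-b , λ Y Y-b → ℤₚ.≤-trans (X-max Y Y-b) δX≤δ[X∩Z]
    where
    X∩Z-b : OnSide b (X ∩ Z)
    X∩Z-b v v∈X∩Z = X-b v (proj₁ (x∈p∩q⁻ X Z v∈X∩Z))
    X∪Z-b : OnSide b (X ∪ Z)
    X∪Z-b v v∈X∪Z = [ X-b v , Z-b v ]′ (x∈p∪q⁻ X Z v∈X∪Z)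
    δX≤δ[X∩Z] : δ X ℤ.≤ δ (X ∩ Z)
    δX≤δ[X∩Z] = +-cancelʳ-≤ (δ Z) (begin
      δ X ℤ.+ δ Z             ≤⟨ δ-supermodular X Z ⟩
      δ (X ∪ Z) ℤ.+ δ (X ∩ Z) ≤⟨ ℤₚ.+-monoˡ-≤ (δ (X ∩ Z)) (Z-max (X ∪ Z) X∪Z-b) ⟩
      δ Z ℤ.+ δ (X ∩ Z)       ≡⟨ ℤₚ.+-comm (δ Z) (δ (X ∩ Z)) ⟩
      δ (X ∩ Z) ℤ.+ δ Z       ∎)
      where open ℤₚ.≤-Reasoning

  sideSet : Bool → Subset n
  sideSet b = tabulate λ v → does (side v ≟ᵇ b)

  ∈-sideSet⁺ : ∀ {b v} → side v ≡ b → v ∈ sideSet b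
  ∈-sideSet⁺ {b} {v} v-b = ∈-tabulate⁺ (dec-true (side v ≟ᵇ b) v-b)

  ∈-sideSet⁻ : ∀ {b v} → v ∈ sideSet b → side v ≡ b
  ∈-sideSet⁻ {b} {v} v∈b = 
    toWitness {a? = side v ≟ᵇ b} (Equivalence.from T-≡ (trans (isYes≗does _) (∈-tabulate⁻ v∈b)))

  restrict : Bool → Subset n → Subset n
  restrict b S = S ∩ sideSet b

  restrict-onSide : ∀ b S → OnSide b (restrict b S)
  restrict-onSide b S v v∈Sb = ∈-sideSet⁻ (proj₂ (x∈p∩q⁻ S (sideSet b) v∈Sb))

  δ-split : ∀ b S → δ S ≡ δ (restrict b S) ℤ.+ δ (restrict (not b) S)
  δ-split b S = trans (cong δ (sym S≡Sb∪S¬b)) (δ-∪-sides (restrict-onSide b S) (restrict-onSide (not b) S))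
    where
    bySide : ∀ {v} → v ∈ S → v ∈ restrict b S ⊎ v ∈ restrict (not b) S
    bySide {v} v∈S with side v ≟ᵇ b
    ... | yes v-b  = inj₁ (x∈p∩q⁺ (v∈S , ∈-sideSet⁺ v-b))
    ... | no  v-¬b = inj₂ (x∈p∩q⁺ (v∈S , ∈-sideSet⁺ (¬-not v-¬b)))
    S≡Sb∪S¬b : restrict b S ∪ restrict (not b) S ≡ S
    S≡Sb∪S¬b = ⊆-antisym
      (λ v∈∪ → [ (λ h → proj₁ (x∈p∩q⁻ S _ h)) , (λ h → proj₁ (x∈p∩q⁻ S _ h)) ]′
                 (x∈p∪q⁻ (restrict b S) _ v∈∪))
      (λ v∈S → x∈p∪q⁺ (bySide v∈S))

  nonNeighbours : Bool → Subset n → Subset n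
  nonNeighbours b X = sideSet b ∩ ∁ (N X)

  ∈-nonNeighbours⁺ : ∀ {b X v} → side v ≡ b → v ∉ N X → v ∈ nonNeighbours b X
  ∈-nonNeighbours⁺ v-b v∉NX = x∈p∩q⁺ (∈-sideSet⁺ v-b , x∉p⇒x∈∁p v∉NX)

  ∈-nonNeighbours⁻ : ∀ {b} X {v} → v ∈ nonNeighbours b X → side v ≡ b × v ∉ N X
  ∈-nonNeighbours⁻ {b} X h with x∈p∩q⁻ (sideSet b) (∁ (N X)) h
  ... | v∈b , v∈∁NX = ∈-sideSet⁻ v∈b , x∈∁p⇒x∉p v∈∁NX

  nonNeighbours-onSide : ∀ b X → OnSide b (nonNeighbours b X)
  nonNeighbours-onSide b X v h = proj₁ (∈-nonNeighbours⁻ X h)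

  -- For X ⊆ A this is X⁺ = X ∪ (B − N(X)), the largest independent set meeting A in X.
  extend : Bool → Subset n → Subset n
  extend b X = X ∪ nonNeighbours (not b) X

  extend-independent : ∀ {b X} → OnSide b X → Independent G (extend b X)
  extend-independent {b} {X} X-b u v u∈ v∈ with adj u v in uv
  ... | false = refl
  ... | true with x∈p∪q⁻ X (nonNeighbours (not b) X) u∈ | x∈p∪q⁻ X (nonNeighbours (not b) X) v∈
  ...   | inj₁ u∈X | inj₁ v∈X = contradiction (trans (X-b u u∈X) (sym (X-b v v∈X))) (bipartite u v uv)
  ...   | inj₁ u∈X | inj₂ v∈Xᶜ = contradiction (∈-N⁺ u∈X (trans (adj-sym v u) uv)) (proj₂ (∈-nonNeighbours⁻ X v∈Xᶜ))
  ...   | inj₂ u∈Xᶜ | inj₁ v∈X = contradiction (∈-N⁺ v∈X uv) (proj₂ (∈-nonNeighbours⁻ X u∈Xᶜ))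
  ...   | inj₂ u∈Xᶜ | inj₂ v∈Xᶜ =
    contradiction (trans (proj₁ (∈-nonNeighbours⁻ X u∈Xᶜ)) (sym (proj₁ (∈-nonNeighbours⁻ X v∈Xᶜ)))) (bipartite u v uv)

  ∣extend∣ : ∀ {b X} → OnSide b X → ∣ extend b X ∣ ≡ ∣ X ∣ + ∣ nonNeighbours (not b) X ∣
  ∣extend∣ {b} {X} X-b = ∣∪∣-sides X-b (nonNeighbours-onSide (not b) X)

  δ≡∣extend∣-∣sideSet∣ : ∀ {b X} → OnSide b X → δ X ≡ + ∣ extend b X ∣ ℤ.- + ∣ sideSet (not b) ∣
  δ≡∣extend∣-∣sideSet∣ {b} {X} X-b = begin
    + ∣ X ∣ ℤ.- + ∣ N X ∣
      ≡⟨ [m+k]-[k+n]≡m-n (∣ X ∣) (∣ N X ∣) (∣ Xᶜ ∣) ⟨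
    + (∣ X ∣ + ∣ Xᶜ ∣) ℤ.- + (∣ Xᶜ ∣ + ∣ N X ∣)
      ≡⟨ cong₂ (λ a c → + a ℤ.- + c) (sym (∣extend∣ X-b)) (∣p∩∁q∣+∣q∣≡∣p∣ NX⊆¬b) ⟩
    + ∣ extend b X ∣ ℤ.- + ∣ sideSet (not b) ∣
      ∎
    where
    open ≡-Reasoning
    Xᶜ = nonNeighbours (not b) X
    NX⊆¬b : N X ⊆ sideSet (not b)
    NX⊆¬b v∈NX = ∈-sideSet⁺ (N-onSide X-b _ v∈NX)

  ⊆-extend : ∀ {b I P} → Independent G I → OnSide b P → P ⊆ I →
             (∀ {v} → v ∈ I → side v ≡ b → v ∈ P) → I ⊆ extend b P
  ⊆-extend {b} {P = P} I-indep P-b P⊆I I∩b⊆P {v} v∈I with side v ≟ᵇ b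
  ... | yes v-b  = x∈p∪q⁺ (inj₁ (I∩b⊆P v∈I v-b))
  ... | no  v-¬b = x∈p∪q⁺ (inj₂ (∈-nonNeighbours⁺ {X = P} (¬-not v-¬b) v∉NP))
    where
    v∉NP : v ∉ N P
    v∉NP v∈NP with ∈-N⁻ P v∈NP
    ... | u , u∈P , vu = not-¬ vu (I-indep v u v∈I (P⊆I u∈P))

  ⊆-extend-restrict : ∀ b {I} → Independent G I → I ⊆ extend b (restrict b I)
  ⊆-extend-restrict b {I} I-indep = ⊆-extend I-indep (restrict-onSide b I)
    (λ v∈Ib → proj₁ (x∈p∩q⁻ I (sideSet b) v∈Ib)) (λ v∈I v-b → x∈p∩q⁺ (v∈I , ∈-sideSet⁺ v-b))

  ∣extend∣-maximal : ∀ {b X Y} → Critical b X → OnSide b Y → ∣ extend b Y ∣ ≤ ∣ extend b X ∣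
  ∣extend∣-maximal {b} {Y = Y} (X-b , X-max) Y-b =
    ℤₚ.drop‿+≤+ (+-cancelʳ-≤ (ℤ.- + ∣ sideSet (not b) ∣)
      (subst₂ ℤ._≤_ (δ≡∣extend∣-∣sideSet∣ Y-b) (δ≡∣extend∣-∣sideSet∣ X-b) (X-max Y Y-b)))

  criticalIndependent-∪ : ∀ {b P Q} → Critical b P → Critical (not b) Q → Independent G (P ∪ Q) →
                          CriticalIndependent G (P ∪ Q)
  criticalIndependent-∪ {b} {P} {Q} (P-b , P-max) (Q-¬b , Q-max) P∪Q-indep = P∪Q-indep , λ I _ → begin
    δ I                                              ≡⟨ δ-split b I ⟩
    δ (restrict b I) ℤ.+ δ (restrict (not b) I)      ≤⟨ ℤₚ.+-mono-≤ (P-max _ (restrict-onSide b I))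
                                                                     (Q-max _ (restrict-onSide (not b) I)) ⟩
    δ P ℤ.+ δ Q                                      ≡⟨ δ-∪-sides P-b Q-¬b ⟨
    δ (P ∪ Q)                                        ∎
    where open ℤₚ.≤-Reasoning

  module _ {α : ℕ} (hα : IsIndependenceNumber G α) where

    private
      α-bound : ∀ {I} → Independent G I → ∣ I ∣ ≤ α
      α-bound {I} = proj₂ hα I

      I* : Subset n
      I* = proj₁ (proj₁ hα)

      I*-independent : Independent G I*
      I*-independent = proj₁ (proj₂ (proj₁ hα))

      ∣I*∣≡α : ∣ I* ∣ ≡ α
      ∣I*∣≡α = proj₂ (proj₂ (proj₁ hα))

      α≤∣extend-restrict-I*∣ : ∀ b → α ≤ ∣ extend b (restrict b I*) ∣
      α≤∣extend-restrict-I*∣ b = subst (λ k → k ≤ ∣ extend b (restrict b I*) ∣) ∣I*∣≡α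
        (p⊆q⇒∣p∣≤∣q∣ (⊆-extend-restrict b I*-independent))

    critical⇐ : ∀ {b X} → OnSide b X → α ≤ ∣ extend b X ∣ → Critical b X
    critical⇐ {b} {X} X-b α≤∣extendX∣ = X-b , λ Y Y-b → begin
      δ Y                                        ≡⟨ δ≡∣extend∣-∣sideSet∣ Y-b ⟩
      + ∣ extend b Y ∣ ℤ.- + ∣ sideSet (not b) ∣ ≤⟨ m≤p∧q≤n⇒m-n≤p-q {n = ∣ sideSet (not b) ∣}
                                                      (ℕ.≤-trans (α-bound (extend-independent Y-b)) α≤∣extendX∣)
                                                      ℕ.≤-refl ⟩
      + ∣ extend b X ∣ ℤ.- + ∣ sideSet (not b) ∣ ≡⟨ δ≡∣extend∣-∣sideSet∣ X-b ⟨
      δ X                                        ∎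
      where open ℤₚ.≤-Reasoning

    critical⇒ : ∀ {b X} → Critical b X → ∣ extend b X ∣ ≡ α
    critical⇒ {b} X-crit = ℕ.≤-antisym (α-bound (extend-independent (proj₁ X-crit)))
      (ℕ.≤-trans (α≤∣extend-restrict-I*∣ b) (∣extend∣-maximal X-crit (restrict-onSide b I*)))

    critical? : ∀ b X → Dec (Critical b X)
    critical? b X = map′ (λ (X-b , ∣extendX∣≡α) → critical⇐ X-b (ℕ.≤-reflexive (sym ∣extendX∣≡α)))
                         (λ X-crit → proj₁ X-crit , critical⇒ X-crit)
                         (onSide? b X ×-dec ∣ extend b X ∣ ≟ α)

    critical-exists : ∀ b → ∃ (Critical b)
    critical-exists b = restrict b I* , critical⇐ (restrict-onSide b I*) (α≤∣extend-restrict-I*∣ b)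

    maximum⇒critical : ∀ {b I P} → Independent G I → ∣ I ∣ ≡ α → OnSide b P → P ⊆ I →
                       (∀ {v} → v ∈ I → side v ≡ b → v ∈ P) → Critical b P
    maximum⇒critical {P = P} I-indep ∣I∣≡α P-b P⊆I I∩b⊆P = critical⇐ P-b
      (subst (λ k → k ≤ ∣ extend _ P ∣) ∣I∣≡α (p⊆q⇒∣p∣≤∣q∣ (⊆-extend I-indep P-b P⊆I I∩b⊆P)))

    critical-flip : ∀ {b Y} → Critical b Y → Critical (not b) (nonNeighbours (not b) Y)
    critical-flip {b} {Y} Y-crit =
      maximum⇒critical (extend-independent Y-b) (critical⇒ Y-crit) (nonNeighbours-onSide (not b) Y)
        (λ v∈Yᶜ → x∈p∪q⁺ (inj₂ v∈Yᶜ)) extend∩¬b⊆Yᶜ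
      where
      Y-b = proj₁ Y-crit
      extend∩¬b⊆Yᶜ : ∀ {v} → v ∈ extend b Y → side v ≡ not b → v ∈ nonNeighbours (not b) Y
      extend∩¬b⊆Yᶜ v∈ v-¬b =
        [ (λ v∈Y → contradiction v-¬b (not-¬ (Y-b _ v∈Y))) , (λ v∈Yᶜ → v∈Yᶜ) ]′ (x∈p∪q⁻ Y _ v∈)

    kernel-critical : ∀ {b K} → IsIntersection G (Critical b) K → Critical b K
    kernel-critical {b} {K} K-ker =
      let (S , S-crit , K⊆S , S⊆K) = meet (allFin n)
      in subst (Critical b) (⊆-antisym (λ {v} v∈S → S⊆K (∈-allFin v) v∈S) K⊆S) S-crit
      where
      K-below : ∀ {S} → Critical b S → K ⊆ S
      K-below S-crit {v} v∈K = Equivalence.to (K-ker v) v∈K _ S-crit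
      -- Criticality is decidable, so a critical set missing v ∉ K is found by searching all subsets.
      avoiding : ∀ v → Σ (Subset n) λ S → Critical b S × (v ∈ S → v ∈ K)
      avoiding v with v ∈? K
      ... | yes v∈K = proj₁ (critical-exists b) , proj₂ (critical-exists b) , λ _ → v∈K
      ... | no  v∉K = fromSearch (anySubset? (λ S → critical? b S ×-dec ¬? (v ∈? S)))
        where
        fromSearch : Dec (∃ λ S → Critical b S × v ∉ S) → Σ (Subset n) λ S → Critical b S × (v ∈ S → v ∈ K)
        fromSearch (yes (S , S-crit , v∉S)) = S , S-crit , λ v∈S → contradiction v∈S v∉S
        fromSearch (no ∄S) = contradiction (Equivalence.from (K-ker v) λ S S-crit →
                               decidable-stable (v ∈? S) λ v∉S → ∄S (S , S-crit , v∉S)) v∉K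
      meet : (L : List (Fin n)) →
             Σ (Subset n) λ S → Critical b S × K ⊆ S × (∀ {v} → v ∈ₗ L → v ∈ S → v ∈ K)
      meet [] = let (X , X-crit) = critical-exists b in X , X-crit , K-below X-crit , λ ()
      meet (v ∷ L) with meet L | avoiding v
      ... | S , S-crit , K⊆S , S⊆K | T , T-crit , T∋v⇒K∋v =
        T ∩ S , critical-∩ T-crit S-crit , (λ w∈K → x∈p∩q⁺ (K-below T-crit w∈K , K⊆S w∈K)) , λ where
          (here refl) w∈T∩S → T∋v⇒K∋v (proj₁ (x∈p∩q⁻ T S w∈T∩S))
          (there w∈L) w∈T∩S → S⊆K w∈L (proj₂ (x∈p∩q⁻ T S w∈T∩S))

    extend-criticalIndependent : ∀ {b X} → Critical b X → CriticalIndependent G (extend b X)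
    extend-criticalIndependent X-crit =
      criticalIndependent-∪ X-crit (critical-flip X-crit) (extend-independent (proj₁ X-crit))

    restrict-critical : ∀ b {S} → CriticalIndependent G S → Critical b (restrict b S)
    restrict-critical b {S} (_ , S-max) = restrict-onSide b S , λ Y Y-b → ℤₚ.≤-trans (X-max Y Y-b) δX≤δSb
      where
      X = proj₁ (critical-exists b)
      X-b = proj₁ (proj₂ (critical-exists b))
      X-max = proj₂ (proj₂ (critical-exists b))
      Xᶜ = nonNeighbours (not b) X
      Sb = restrict b S
      δX≤δSb : δ X ℤ.≤ δ Sb
      δX≤δSb = +-cancelʳ-≤ (δ Xᶜ) (begin
        δ X ℤ.+ δ Xᶜ                     ≡⟨ δ-∪-sides X-b (nonNeighbours-onSide (not b) X) ⟨
        δ (extend b X)                   ≤⟨ S-max _ (extend-independent X-b) ⟩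
        δ S                              ≡⟨ δ-split b S ⟩
        δ Sb ℤ.+ δ (restrict (not b) S)  ≤⟨ ℤₚ.+-monoʳ-≤ (δ Sb) (proj₂ (critical-flip (proj₂ (critical-exists b)))
                                                                       _ (restrict-onSide (not b) S)) ⟩
        δ Sb ℤ.+ δ Xᶜ                    ∎)
        where open ℤₚ.≤-Reasoning

    kernel-onSide : ∀ {b K} → IsIntersection G (Critical b) K → OnSide b K
    kernel-onSide K-ker = proj₁ (kernel-critical K-ker)

    kernel-side⊆kernel : ∀ {b K Kb} → IsKer G K → IsIntersection G (Critical b) Kb → Kb ⊆ K
    kernel-side⊆kernel {b} {Kb = Kb} K-ker Kb-ker {v} v∈Kb = Equivalence.from (K-ker v) λ S S-ci →
      proj₁ (x∈p∩q⁻ S (sideSet b) (Equivalence.to (Kb-ker v) v∈Kb _ (restrict-critical b S-ci)))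

    kernel∩side⊆kernel-side : ∀ {b K Kb} → IsKer G K → IsIntersection G (Critical b) Kb →
                              ∀ {v} → v ∈ K → side v ≡ b → v ∈ Kb
    kernel∩side⊆kernel-side {Kb = Kb} K-ker Kb-ker {v} v∈K v-b =
      [ (λ v∈Kb → v∈Kb) , (λ v∈Kbᶜ → contradiction (proj₁ (∈-nonNeighbours⁻ Kb v∈Kbᶜ)) (not-¬ v-b)) ]′
        (x∈p∪q⁻ Kb _ (Equivalence.to (K-ker v) v∈K _ (extend-criticalIndependent (kernel-critical Kb-ker))))

    diadem-side⊆diadem : ∀ {b D Db} → IsDiadem G D → IsUnion G (Critical b) Db → Db ⊆ D
    diadem-side⊆diadem {b} D-union Db-union {v} v∈Db with Equivalence.to (Db-union v) v∈Db
    ... | S , S-crit , v∈S =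
      Equivalence.from (D-union v) (extend b S , extend-criticalIndependent S-crit , x∈p∪q⁺ (inj₁ v∈S))

    diadem∩side⊆diadem-side : ∀ {b D Db} → IsDiadem G D → IsUnion G (Critical b) Db →
                              ∀ {v} → v ∈ D → side v ≡ b → v ∈ Db
    diadem∩side⊆diadem-side {b} D-union Db-union {v} v∈D v-b with Equivalence.to (D-union v) v∈D
    ... | S , S-ci , v∈S =
      Equivalence.from (Db-union v) (restrict b S , restrict-critical b S-ci , x∈p∩q⁺ (v∈S , ∈-sideSet⁺ v-b))

    diadem≡nonNeighbours-kernel : ∀ {b K D} → IsIntersection G (Critical b) K →
                                  IsUnion G (Critical (not b)) D → D ≡ nonNeighbours (not b) K
    diadem≡nonNeighbours-kernel {b} {K} {D} K-ker D-union = ⊆-antisym D⊆Kᶜ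
      (λ {v} v∈Kᶜ → Equivalence.from (D-union v) (_ , critical-flip (kernel-critical K-ker) , v∈Kᶜ))
      where
      D⊆Kᶜ : D ⊆ nonNeighbours (not b) K
      D⊆Kᶜ {v} v∈D with Equivalence.to (D-union v) v∈D
      ... | S , S-crit , v∈S = ∈-nonNeighbours⁺ {X = K} (proj₁ S-crit v v∈S) v∉NK
        where
        Sᶜ-crit : Critical b (nonNeighbours b S)
        Sᶜ-crit = subst (λ c → Critical c (nonNeighbours c S)) (not-involutive b) (critical-flip S-crit)
        v∉NK : v ∉ N K
        v∉NK v∈NK with ∈-N⁻ K v∈NK
        ... | u , u∈K , vu = proj₂ (∈-nonNeighbours⁻ S (Equivalence.to (K-ker u) u∈K _ Sᶜ-crit))
                                   (∈-N⁺ v∈S (trans (adj-sym u v) vu))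

    ∣kernel∣+∣diadem∣≡α : ∀ {b K D} → IsIntersection G (Critical b) K →
                           IsUnion G (Critical (not b)) D → ∣ K ∣ + ∣ D ∣ ≡ α
    ∣kernel∣+∣diadem∣≡α {b} {K} {D} K-ker D-union = begin
      ∣ K ∣ + ∣ D ∣                          ≡⟨ cong (λ X → ∣ K ∣ + ∣ X ∣) (diadem≡nonNeighbours-kernel K-ker D-union) ⟩
      ∣ K ∣ + ∣ nonNeighbours (not b) K ∣    ≡⟨ ∣extend∣ (proj₁ K-crit) ⟨
      ∣ extend b K ∣                         ≡⟨ critical⇒ K-crit ⟩
      α                                      ∎
      where
      open ≡-Reasoning
      K-crit = kernel-critical K-ker

mainTheorem6 : ∀ {n : ℕ} (G : BipGraph n)
    (K D KA DA KB DB : Subset n) (α : ℕ) →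
    IsKer G K → IsDiadem G D → IsKerA G KA → IsDiademA G DA →
    IsKerB G KB → IsDiademB G DB → IsIndependenceNumber G α →
    (KA ∪ KB ≡ K)
    × (∣ K ∣ + ∣ D ∣ ≡ 2 * α)
    × (∣ KA ∣ + ∣ DB ∣ ≡ α × ∣ KB ∣ + ∣ DA ∣ ≡ α)
    × (DA ∪ DB ≡ D)
mainTheorem6 G K D KA DA KB DB α K-ker D-union KA-ker DA-union KB-ker DB-union hα =
  K≡KA∪KB , ∣K∣+∣D∣≡2α , (∣KA∣+∣DB∣≡α , ∣KB∣+∣DA∣≡α) , D≡DA∪DB
  where
  open ≡-Reasoning
  K≡KA∪KB : KA ∪ KB ≡ K
  K≡KA∪KB = ∪-sides≡ G (kernel-side⊆kernel G hα K-ker KA-ker) (kernel-side⊆kernel G hα K-ker KB-ker)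
    (kernel∩side⊆kernel-side G hα K-ker KA-ker) (kernel∩side⊆kernel-side G hα K-ker KB-ker)
  D≡DA∪DB : DA ∪ DB ≡ D
  D≡DA∪DB = ∪-sides≡ G (diadem-side⊆diadem G hα D-union DA-union) (diadem-side⊆diadem G hα D-union DB-union)
    (diadem∩side⊆diadem-side G hα D-union DA-union) (diadem∩side⊆diadem-side G hα D-union DB-union)
  ∣KA∣+∣DB∣≡α : ∣ KA ∣ + ∣ DB ∣ ≡ α
  ∣KA∣+∣DB∣≡α = ∣kernel∣+∣diadem∣≡α G hα KA-ker DB-union
  ∣KB∣+∣DA∣≡α : ∣ KB ∣ + ∣ DA ∣ ≡ α
  ∣KB∣+∣DA∣≡α = ∣kernel∣+∣diadem∣≡α G hα KB-ker DA-union
  ∣K∣+∣D∣≡2α : ∣ K ∣ + ∣ D ∣ ≡ 2 * α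
  ∣K∣+∣D∣≡2α = begin
    ∣ K ∣ + ∣ D ∣                            ≡⟨ cong₂ (λ X Y → ∣ X ∣ + ∣ Y ∣) K≡KA∪KB D≡DA∪DB ⟨
    ∣ KA ∪ KB ∣ + ∣ DA ∪ DB ∣                ≡⟨ cong₂ _+_
         (∣∪∣-sides G (kernel-onSide G hα KA-ker) (kernel-onSide G hα KB-ker))
         (∣∪∣-sides G (union-onSide G DA-union) (union-onSide G DB-union)) ⟩
    (∣ KA ∣ + ∣ KB ∣) + (∣ DA ∣ + ∣ DB ∣)    ≡⟨ cong (λ k → (∣ KA ∣ + ∣ KB ∣) + k) (ℕ.+-comm (∣ DA ∣) (∣ DB ∣)) ⟩
    (∣ KA ∣ + ∣ KB ∣) + (∣ DB ∣ + ∣ DA ∣)    ≡⟨ interchange ℕ.+-commutativeSemigroup (∣ KA ∣) (∣ KB ∣) (∣ DB ∣) (∣ DA ∣) ⟩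
    (∣ KA ∣ + ∣ DB ∣) + (∣ KB ∣ + ∣ DA ∣)    ≡⟨ cong₂ _+_ ∣KA∣+∣DB∣≡α ∣KB∣+∣DA∣≡α ⟩
    α + α                                    ≡⟨ cong (λ k → α + k) (ℕ.+-identityʳ α) ⟨
    2 * α                                    ∎
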